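{- If $A\to X$ and $B\to Y$ are cofibrations of digraphs, then their box product $A\mathbin{\square}B\to X\mathbin{\square}Y$ is a cofibration.
   Context: A digraph $X$ is a set $X_V$ with a reflexive binary relation ($x\to y$ an edge); maps preserve the relation. Induced subgraph $A\subseteq X$: for $a,b\in A_V$, $a\to b$ in $A$ iff in $X$. Path of length $n$: $v_0\to\dots\to v_n$. $X^A$: induced subgraph on vertices admitting a path to some vertex of $A$. A projecting decomposition of $X$ w.r.t. $A$: $\pi\colon X^A_V\to A_V$ such that for any $x\in X_V$ and $a\in A_V$ admitting a path from $x$, some minimal-length path from $x$ to $a$ passes through $\pi x$. A cofibration: an induced subgraph inclusion $A\to X$ with no edges from vertices of $A$ to vertices outside $A$, such that $X$ admits a projecting decomposition w.r.t. $A$. The box product $X\mathbin{\square}Y$ has vertex set $X_V\times Y_V$ and an edge $(x,x')\to(y,y')$ iff either $x\to y$ in $X$ and $x'=y'$, or $x'\to y'$ in $Y$ and $x=y$; for maps, $f\mathbin{\square}g$ acts componentwise. -}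

module Defs where

open import Data.Nat using (ℕ; zero; suc; _≤_)
open import Data.Product using (Σ; ∃; _×_; _,_)
open import Data.Sum using (_⊎_)
open import Function using (_⇔_)
open import Relation.Binary.PropositionalEquality using (_≡_)

record Digraph : Set₁ where
  field
    V    : Set
    _⇒_  : V → V → Set
    refl⇒ : ∀ x → x ⇒ x
open Digraph public

record Hom (X Y : Digraph) : Set where
  field
    fun  : V X → V Y
    pres : ∀ {x y} → _⇒_ X x y → _⇒_ Y (fun x) (fun y)
open Hom public

data Path (X : Digraph) : V X → V X → ℕ → Set where
  []  : ∀ x → Path X x x zero
  _∷_ : ∀ {x y z n} → _⇒_ X x y → Path X y z n → Path X x z (suc n)

data Visits {X : Digraph} (v : V X) : ∀ {x y n} → Path X x y n → Set where
  here-[] : Visits v ([] v)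
  here    : ∀ {y z n} (e : _⇒_ X v y) (p : Path X y z n) → Visits v (e ∷ p)
  there   : ∀ {x y z n} (e : _⇒_ X x y) {p : Path X y z n} → Visits v p → Visits v (e ∷ p)

MinimalPath : (X : Digraph) {x y : V X} {n : ℕ} → Path X x y n → Set
MinimalPath X {x} {y} {n} _ = ∀ m → Path X x y m → n ≤ m

module _ {A X : Digraph} (i : Hom A X) where

  ReachesA : V X → Set
  ReachesA x = Σ (V A) λ a → Σ ℕ λ n → Path X x (fun i a) n

  VXA : Set
  VXA = Σ (V X) ReachesA

  IsProjectingDecomposition : (VXA → V A) → Set
  IsProjectingDecomposition π =
    ∀ (x : V X) (a : V A) → (Σ ℕ λ n → Path X x (fun i a) n) →
    ∀ (h : ReachesA x) →
    Σ ℕ λ n → Σ (Path X x (fun i a) n) λ p →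
      MinimalPath X p × Visits (fun i (π (x , h))) p

  HasProjectingDecomposition : Set
  HasProjectingDecomposition = Σ (VXA → V A) IsProjectingDecomposition

  IsInducedSubgraphInclusion : Set
  IsInducedSubgraphInclusion =
    (∀ a b → fun i a ≡ fun i b → a ≡ b) ×
    (∀ a b → _⇒_ A a b ⇔ _⇒_ X (fun i a) (fun i b))

  NoOutgoingEdges : Set
  NoOutgoingEdges = ∀ a x → _⇒_ X (fun i a) x → Σ (V A) λ b → fun i b ≡ x

  IsCofibration : Set
  IsCofibration = IsInducedSubgraphInclusion × NoOutgoingEdges × HasProjectingDecomposition

_□_ : Digraph → Digraph → Digraph
X □ Y = record
  { V = V X × V Y
  ; _⇒_ = λ { (x , x') (y , y') → (_⇒_ X x y × x' ≡ y') ⊎ (x ≡ y × _⇒_ Y x' y') }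
  ; refl⇒ = λ { (x , x') → Data.Sum.inj₁ (refl⇒ X x , Relation.Binary.PropositionalEquality.refl) }
  }

_□ₘ_ : ∀ {A X B Y} → Hom A X → Hom B Y → Hom (A □ B) (X □ Y)
f □ₘ g = record
  { fun = λ { (a , b) → fun f a , fun g b }
  ; pres = λ { (Data.Sum.inj₁ (e , Relation.Binary.PropositionalEquality.refl)) →
                 Data.Sum.inj₁ (pres f e , Relation.Binary.PropositionalEquality.refl)
             ; (Data.Sum.inj₂ (Relation.Binary.PropositionalEquality.refl , e)) →
                 Data.Sum.inj₂ (Relation.Binary.PropositionalEquality.refl , pres g e) }
  }

{-# OPTIONS --safe #-}
-- A path in X □ Y is an interleaving of a path in X and a path in Y, so the distance
-- from (x , y) to (x' , y') is the sum of the distances from x to x' and from y to y'.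
-- Hence X^{A□B} ⊆ X^A × Y^B, and π(x , y) := (π_A x , π_B y) is a projecting
-- decomposition: walking a minimal X-path to π_A x, a minimal Y-path to π_B y, and then
-- the remainders of both gives a path of minimal length through (π_A x , π_B y).
-- The other properties of a cofibration hold componentwise.
module Submission where

open import Defs
open import Algebra.Properties.CommutativeSemigroup using (interchange)
open import Data.Nat using (ℕ; suc; _+_; _≤_)
open import Data.Nat.Properties using (+-mono-≤; ≤-trans; ≤-reflexive; +-suc; +-commutativeSemigroup)
open import Data.Product using (Σ; _×_; _,_; proj₁; proj₂)
open import Data.Sum using (inj₁; inj₂)
open import Function using (_⇔_; mk⇔; Equivalence)
open import Relation.Binary.PropositionalEquality using (_≡_; refl; trans; cong; cong₂)

module _ {X : Digraph} where

  infixr 5 _++ᴾ_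

  _++ᴾ_ : ∀ {x y z n m} → Path X x y n → Path X y z m → Path X x z (n + m)
  [] _    ++ᴾ q = q
  (e ∷ p) ++ᴾ q = e ∷ (p ++ᴾ q)

  visits-source : ∀ {x y n} (p : Path X x y n) → Visits x p
  visits-source ([] _)  = here-[]
  visits-source (e ∷ p) = here e p

  visits-++ʳ : ∀ {x y z n m v} (p : Path X x y n) {q : Path X y z m} →
    Visits v q → Visits v (p ++ᴾ q)
  visits-++ʳ ([] _)  v∈q = v∈q
  visits-++ʳ (e ∷ p) v∈q = there e (visits-++ʳ p v∈q)

  split-at-visit : ∀ {v x z n} {p : Path X x z n} → Visits v p →
    Σ ℕ λ n₁ → Σ ℕ λ n₂ → Path X x v n₁ × Path X v z n₂ × n₁ + n₂ ≡ n
  split-at-visit here-[]        = 0 , 0 , [] _ , [] _ , refl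
  split-at-visit (here e p)     = 0 , _ , [] _ , e ∷ p , refl
  split-at-visit (there e v∈p) with split-at-visit v∈p
  ... | n₁ , n₂ , p₁ , p₂ , n₁+n₂≡n = suc n₁ , n₂ , e ∷ p₁ , p₂ , cong suc n₁+n₂≡n

module _ {X Y : Digraph} where

  path-□ˡ : ∀ {x x' n} → Path X x x' n → (y : V Y) → Path (X □ Y) (x , y) (x' , y) n
  path-□ˡ ([] _)  y = [] _
  path-□ˡ (e ∷ p) y = inj₁ (e , refl) ∷ path-□ˡ p y

  path-□ʳ : ∀ {y y' n} → (x : V X) → Path Y y y' n → Path (X □ Y) (x , y) (x , y') n
  path-□ʳ x ([] _)  = [] _
  path-□ʳ x (e ∷ p) = inj₂ (refl , e) ∷ path-□ʳ x p

  unzip-path-□ : ∀ {u v : V (X □ Y)} {k} → Path (X □ Y) u v k →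
    Σ ℕ λ k₁ → Σ ℕ λ k₂ →
      Path X (proj₁ u) (proj₁ v) k₁ × Path Y (proj₂ u) (proj₂ v) k₂ × k₁ + k₂ ≡ k
  unzip-path-□ ([] _) = 0 , 0 , [] _ , [] _ , refl
  unzip-path-□ (inj₁ (e , refl) ∷ r) with unzip-path-□ r
  ... | k₁ , k₂ , p , q , k₁+k₂≡k = suc k₁ , k₂ , e ∷ p , q , cong suc k₁+k₂≡k
  unzip-path-□ (inj₂ (refl , e) ∷ r) with unzip-path-□ r
  ... | k₁ , k₂ , p , q , k₁+k₂≡k = k₁ , suc k₂ , p , e ∷ q , trans (+-suc k₁ k₂) (cong suc k₁+k₂≡k)

  minimal-length-□ : ∀ {x x' y y' n m k} {p : Path X x x' n} {q : Path Y y y' m} →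
    MinimalPath X p → MinimalPath Y q → Path (X □ Y) (x , y) (x' , y') k → n + m ≤ k
  minimal-length-□ p-min q-min r with unzip-path-□ r
  ... | k₁ , k₂ , r₁ , r₂ , k₁+k₂≡k =
    ≤-trans (+-mono-≤ (p-min k₁ r₁) (q-min k₂ r₂)) (≤-reflexive k₁+k₂≡k)

  path-□-through : ∀ {x x' y y' v w n m} {p : Path X x x' n} {q : Path Y y y' m} →
    Visits v p → Visits w q →
    Σ ℕ λ k → Σ (Path (X □ Y) (x , y) (x' , y') k) λ r → k ≡ n + m × Visits (v , w) r
  path-□-through {x} {x'} {y} {y'} {v} {w} v∈p w∈q
    with split-at-visit v∈p | split-at-visit w∈q
  ... | n₁ , n₂ , p₁ , p₂ , refl | m₁ , m₂ , q₁ , q₂ , refl =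
    _ , before ++ᴾ after ,
    interchange +-commutativeSemigroup n₁ m₁ n₂ m₂ ,
    visits-++ʳ before (visits-source after)
    where
    before : Path (X □ Y) (x , y) (v , w) (n₁ + m₁)
    before = path-□ˡ p₁ y ++ᴾ path-□ʳ v q₁
    after : Path (X □ Y) (v , w) (x' , y') (n₂ + m₂)
    after = path-□ˡ p₂ w ++ᴾ path-□ʳ x' q₂

  minimal-path-□-through : ∀ {x x' y y' v w n m} {p : Path X x x' n} {q : Path Y y y' m} →
    MinimalPath X p → MinimalPath Y q → Visits v p → Visits w q →
    Σ ℕ λ k → Σ (Path (X □ Y) (x , y) (x' , y') k) λ r → MinimalPath (X □ Y) r × Visits (v , w) r
  minimal-path-□-through {p = p} {q} p-min q-min v∈p w∈q with path-□-through v∈p w∈q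
  ... | k , r , k≡n+m , vw∈r = k , r , r-min , vw∈r
    where
    r-min : MinimalPath (X □ Y) r
    r-min k' r' = ≤-trans (≤-reflexive k≡n+m) (minimal-length-□ {p = p} {q} p-min q-min r')

module _ {A X B Y : Digraph} (i : Hom A X) (j : Hom B Y) where

  □ₘ-induced : IsInducedSubgraphInclusion i → IsInducedSubgraphInclusion j →
    IsInducedSubgraphInclusion (i □ₘ j)
  □ₘ-induced (i-inj , i-edges) (j-inj , j-edges) = injective , edges
    where
    injective : ∀ u v → fun (i □ₘ j) u ≡ fun (i □ₘ j) v → u ≡ v
    injective (a , b) (a' , b') eq =
      cong₂ _,_ (i-inj a a' (cong proj₁ eq)) (j-inj b b' (cong proj₂ eq))

    reflect : ∀ {a a' b b'} → _⇒_ (X □ Y) (fun i a , fun j b) (fun i a' , fun j b') →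
      _⇒_ (A □ B) (a , b) (a' , b')
    reflect {a} {a'} {b} {b'} (inj₁ (e , eq)) = inj₁ (Equivalence.from (i-edges a a') e , j-inj b b' eq)
    reflect {a} {a'} {b} {b'} (inj₂ (eq , e)) = inj₂ (i-inj a a' eq , Equivalence.from (j-edges b b') e)

    edges : ∀ u v → _⇒_ (A □ B) u v ⇔ _⇒_ (X □ Y) (fun (i □ₘ j) u) (fun (i □ₘ j) v)
    edges u v = mk⇔ (pres (i □ₘ j)) reflect

  □ₘ-noOutgoingEdges : NoOutgoingEdges i → NoOutgoingEdges j → NoOutgoingEdges (i □ₘ j)
  □ₘ-noOutgoingEdges i-closed j-closed (a , b) (x , y) (inj₁ (e , refl)) with i-closed a x e
  ... | a' , ia'≡x = (a' , b) , cong (_, fun j b) ia'≡x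
  □ₘ-noOutgoingEdges i-closed j-closed (a , b) (x , y) (inj₂ (refl , e)) with j-closed b y e
  ... | b' , jb'≡y = (a , b') , cong (fun i a ,_) jb'≡y

  reachesA-□ˡ : ∀ {x y} → ReachesA (i □ₘ j) (x , y) → ReachesA i x
  reachesA-□ˡ ((a , b) , k , r) with unzip-path-□ {X = X} {Y} r
  ... | k₁ , _ , r₁ , _ , _ = a , k₁ , r₁

  reachesA-□ʳ : ∀ {x y} → ReachesA (i □ₘ j) (x , y) → ReachesA j y
  reachesA-□ʳ ((a , b) , k , r) with unzip-path-□ {X = X} {Y} r
  ... | _ , k₂ , _ , r₂ , _ = b , k₂ , r₂

  □ₘ-projectingDecomposition : HasProjectingDecomposition i → HasProjectingDecomposition j →
    HasProjectingDecomposition (i □ₘ j)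
  □ₘ-projectingDecomposition (πᵢ , πᵢ-proj) (πⱼ , πⱼ-proj) = π , π-proj
    where
    π : VXA (i □ₘ j) → V (A □ B)
    π ((x , y) , h) = πᵢ (x , reachesA-□ˡ h) , πⱼ (y , reachesA-□ʳ h)

    π-proj : IsProjectingDecomposition (i □ₘ j) π
    π-proj (x , y) (a , b) (k , r) h with unzip-path-□ {X = X} {Y} r
    ... | k₁ , k₂ , r₁ , r₂ , _
      with πᵢ-proj x a (k₁ , r₁) (reachesA-□ˡ h) | πⱼ-proj y b (k₂ , r₂) (reachesA-□ʳ h)
    ... | _ , _ , p-min , v∈p | _ , _ , q-min , w∈q = minimal-path-□-through p-min q-min v∈p w∈q

proposition2p12 : {A X B Y : Digraph} (i : Hom A X) (j : Hom B Y) →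
    IsCofibration i → IsCofibration j → IsCofibration (i □ₘ j)
proposition2p12 i j (i-induced , i-closed , i-proj) (j-induced , j-closed , j-proj) =
  □ₘ-induced i j i-induced j-induced ,
  □ₘ-noOutgoingEdges i j i-closed j-closed ,
  □ₘ-projectingDecomposition i j i-proj j-proj
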